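{- Let $n \ge 4$ be even and let $G = C(n;1,n/2)$. Then $$b(G) = \left\lceil \frac{1+\sqrt{2n+1}}{2}\right\rceil.$$
   Context: For an integer $n$ and positive integers $s_1<\dots<s_t\le n/2$, the circulant graph $C(n;s_1,\dots,s_t)$ has vertex set $\mathbb Z_n$, with distinct vertices $x,y$ adjacent iff $x-y \equiv \pm s_i \pmod n$ for some $i$. For a finite connected graph $G$, a vertex $x$ and integer $\ell\ge0$, let $N_\ell[x]=\{y: d(x,y)\le \ell\}$. A sequence of vertices $(x_1,\dots,x_k)$ is a burning sequence of $G$ if $N_{k-1}[x_1]\cup N_{k-2}[x_2]\cup\cdots\cup N_0[x_k]=V(G)$ (this corresponds to the burning process: at time step $i$ vertex $x_i$ is set on fire, and at each step the fire spreads from every burned vertex to all its neighbours). The burning number $b(G)$ is the minimum length of a burning sequence of $G$. -}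

module Defs where

open import Data.Nat using (ℕ; zero; suc; _+_; _*_; _∸_; _^_; _≤_; _<_; NonZero)
open import Data.Nat.DivMod using (_%_)
open import Data.Fin using (Fin; toℕ)
open import Data.Vec using (Vec; lookup)
open import Data.List using (List)
open import Data.List.Membership.Propositional using (_∈_)
open import Data.Product using (Σ; ∃; ∃-syntax; _×_)
open import Data.Sum using (_⊎_)
open import Relation.Binary.PropositionalEquality using (_≡_; _≢_)
open import Relation.Nullary using (¬_)

Graph : Set → Set₁
Graph V = V → V → Set

data Walk {V : Set} (G : Graph V) : V → V → ℕ → Set where
  here : ∀ {x} → Walk G x x 0
  step : ∀ {x y z ℓ} → G x y → Walk G y z ℓ → Walk G x z (suc ℓ)

InBall : {V : Set} → Graph V → V → ℕ → V → Set
InBall G x ℓ y = ∃[ m ] (m ≤ ℓ × Walk G x y m)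

-- (x_1,…,x_k) (here indexed by Fin k, x_{i+1} = lookup xs i) is a burning
-- sequence: N_{k-1}[x_1] ∪ … ∪ N_0[x_k] = V(G).
IsBurningSeq : {V : Set} → Graph V → (k : ℕ) → Vec V k → Set
IsBurningSeq {V} G k xs =
  ∀ (v : V) → ∃[ i ] InBall G (lookup xs i) (k ∸ suc (toℕ i)) v

IsBurningNumber : {V : Set} → Graph V → ℕ → Set
IsBurningNumber {V} G b =
  (Σ (Vec V b) (IsBurningSeq G b))
  × (∀ (k : ℕ) (xs : Vec V k) → IsBurningSeq G k xs → b ≤ k)

-- Circulant graph C(n; s_1,…,s_t) on ℤ_n = Fin n: distinct x, y are adjacent
-- iff x - y ≡ ± s_i (mod n) for some i.
Circulant : (n : ℕ) → .{{NonZero n}} → List ℕ → Graph (Fin n)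
Circulant n S x y =
  x ≢ y × ∃[ s ] (s ∈ S ×
    (((toℕ x + n ∸ toℕ y) % n ≡ s % n) ⊎ ((toℕ x + n ∸ toℕ y) % n ≡ (n ∸ s) % n)))

-- k = ⌈(1 + √(2n+1))/2⌉, stated without reals: k is the least natural number
-- with (1 + √(2n+1))/2 ≤ k, i.e. with k ≥ 1 and 2n+1 ≤ (2k-1)².
CeilBound : ℕ → ℕ → Set
CeilBound n k = 1 ≤ k × 2 * n + 1 ≤ (2 * k ∸ 1) ^ 2

IsCeilHalfOnePlusSqrt : ℕ → ℕ → Set
IsCeilHalfOnePlusSqrt n k = CeilBound n k × (∀ j → CeilBound n j → k ≤ j)

-- Let N = 2m. In C(N; 1, m) every walk of length ≤ r from a ends at a + e or a + m + e
-- with |e| ≤ r, resp. |e| < r, so a ball of radius r ≥ 1 has at most 4r vertices and a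
-- ball of radius 0 has one. A burning sequence of length k therefore covers at most
-- 1 + Σ_{0<r<k} 4r = 2k(k − 1) + 1 vertices, which forces m ≤ k(k − 1). Conversely, if
-- m ≤ K(K + 1), balls of radii K, K − 1, …, 0 can be laid along the rungs {c, c + m}:
-- the ball of radius r covers 2r consecutive rungs except for one vertex, which is the
-- first vertex of the next ball, and together they cover K(K + 1) ≥ m rungs, i.e. all of
-- ℤ_N. Finally 2N + 1 ≤ (2k − 1)² holds exactly when m ≤ k(k − 1).
module Submission where

open import Defs
open import Data.Nat using (ℕ; zero; suc; _+_; _*_; _∸_; _^_; _≤_; _<_; z≤n; s≤s; s≤s⁻¹; NonZero; >-nonZero; >-nonZero⁻¹; _≤?_; _/_)
open import Data.Nat.Properties
open import Data.Nat.DivMod using (_%_; _mod_; m/n≤m; m%n<n; %-distribˡ-+; [m+n]%n≡m%n; [m+kn]%n≡m%n; m%n%n≡m%n; m<n⇒m%n≡m; m*n/n≡m)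
open import Data.Nat.ListAction using (sum)
open import Data.Nat.Tactic.RingSolver using (solve-∀)
open import Data.Fin using (Fin; zero; suc; toℕ; fromℕ<)
open import Data.Fin.Properties using (toℕ-injective; toℕ<n; toℕ-fromℕ<; fromℕ<-cong; injective⇒≤; ¬Fin0)
open import Data.List as List using (List; _∷_; []; _++_; length; applyUpTo; applyDownFrom)
open import Data.List.Properties using (length-++; length-applyUpTo)
open import Data.List.Membership.Propositional using (_∈_)
open import Data.List.Membership.Propositional.Properties using (∈-++⁺ˡ; ∈-++⁺ʳ; ∈-applyUpTo⁺)
open import Data.List.Relation.Unary.Any using (here; there; index)
open import Data.List.Relation.Unary.Any.Properties using (lookup-index)
open import Data.Vec using (Vec; _∷_; []; lookup; tabulate)
open import Data.Vec.Properties using (lookup∘tabulate)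
open import Data.Product using (Σ; ∃-syntax; _×_; _,_; proj₁; proj₂)
open import Data.Sum using (_⊎_; inj₁; inj₂)
open import Data.Empty using (⊥-elim)
open import Relation.Nullary using (yes; no)
open import Relation.Binary.PropositionalEquality hiding ([_])
open import Function using (_∘_)

module Modular (n : ℕ) .{{_ : NonZero n}} where

  toℕ-mod : ∀ a → toℕ (a mod n) ≡ a % n
  toℕ-mod a = toℕ-fromℕ< (m%n<n a n)

  %≡⇒mod≡ : ∀ {a b} → a % n ≡ b % n → a mod n ≡ b mod n
  %≡⇒mod≡ eq = fromℕ<-cong _ _ eq (m%n<n _ n) (m%n<n _ n)

  mod≡⇒%≡ : ∀ {a b} → a mod n ≡ b mod n → a % n ≡ b % n
  mod≡⇒%≡ {a} {b} eq = trans (sym (toℕ-mod a)) (trans (cong toℕ eq) (toℕ-mod b))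

  toℕ-mod-id : ∀ (v : Fin n) → toℕ v mod n ≡ v
  toℕ-mod-id v = toℕ-injective (trans (toℕ-mod (toℕ v)) (m<n⇒m%n≡m (toℕ<n v)))

  toℕ-mod-+ : ∀ a b → (toℕ (a mod n) + b) mod n ≡ (a + b) mod n
  toℕ-mod-+ a b = %≡⇒mod≡ (begin
    (toℕ (a mod n) + b) % n     ≡⟨ cong (λ x → (x + b) % n) (toℕ-mod a) ⟩
    (a % n + b) % n             ≡⟨ %-distribˡ-+ (a % n) b n ⟩
    (a % n % n + b % n) % n     ≡⟨ cong (λ x → (x + b % n) % n) (m%n%n≡m%n a n) ⟩
    (a % n + b % n) % n         ≡⟨ %-distribˡ-+ a b n ⟨
    (a + b) % n                 ∎)
    where open ≡-Reasoning

  ≡⇒toℕ-mod-+ : ∀ {y : Fin n} {a} b → y ≡ a mod n → (toℕ y + b) mod n ≡ (a + b) mod n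
  ≡⇒toℕ-mod-+ {a = a} b refl = toℕ-mod-+ a b

  mod-+ʳ : ∀ {a b} c → a mod n ≡ b mod n → (a + c) mod n ≡ (b + c) mod n
  mod-+ʳ {a} {b} c eq =
    trans (sym (toℕ-mod-+ a c)) (trans (cong (λ x → (toℕ x + c) mod n) eq) (toℕ-mod-+ b c))

  mod-+ˡ : ∀ {a b} c → a mod n ≡ b mod n → (c + a) mod n ≡ (c + b) mod n
  mod-+ˡ {a} {b} c eq =
    trans (cong (_mod n) (+-comm c a)) (trans (mod-+ʳ c eq) (cong (_mod n) (+-comm b c)))

  [a+n]mod : ∀ a → (a + n) mod n ≡ a mod n
  [a+n]mod a = %≡⇒mod≡ ([m+n]%n≡m%n a n)

  [a+kn]mod : ∀ a k → (a + k * n) mod n ≡ a mod n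
  [a+kn]mod a k = %≡⇒mod≡ ([m+kn]%n≡m%n a k n)

  mod-cancelˡ-+ : ∀ {a b c} → c < n → (c + a) mod n ≡ (c + b) mod n → a mod n ≡ b mod n
  mod-cancelˡ-+ {a} {b} {c} c<n eq = begin
    a mod n                   ≡⟨ [a+n]mod a ⟨
    (a + n) mod n             ≡⟨ cong (_mod n) (complement a) ⟨
    (c + a + (n ∸ c)) mod n   ≡⟨ mod-+ʳ (n ∸ c) eq ⟩
    (c + b + (n ∸ c)) mod n   ≡⟨ cong (_mod n) (complement b) ⟩
    (b + n) mod n             ≡⟨ [a+n]mod b ⟩
    b mod n                   ∎
    where
    open ≡-Reasoning
    complement : ∀ x → c + x + (n ∸ c) ≡ x + n
    complement x = begin
      c + x + (n ∸ c)   ≡⟨ cong (_+ (n ∸ c)) (+-comm c x) ⟩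
      x + c + (n ∸ c)   ≡⟨ +-assoc x c (n ∸ c) ⟩
      x + (c + (n ∸ c)) ≡⟨ cong (x +_) (m+[n∸m]≡n (<⇒≤ c<n)) ⟩
      x + n             ∎

  mod-solve : ∀ {y : Fin n} {t u x} → (toℕ y + t) mod n ≡ x → t + u ≡ n → y ≡ (toℕ x + u) mod n
  mod-solve {y} {t} {u} refl t+u≡n = begin
    y                               ≡⟨ toℕ-mod-id y ⟨
    a mod n                         ≡⟨ [a+n]mod a ⟨
    (a + n) mod n                   ≡⟨ cong (λ y → (a + y) mod n) t+u≡n ⟨
    (a + (t + u)) mod n             ≡⟨ cong (_mod n) (+-assoc a t u) ⟨
    (a + t + u) mod n               ≡⟨ toℕ-mod-+ (a + t) u ⟨
    (toℕ ((a + t) mod n) + u) mod n ∎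
    where
    open ≡-Reasoning
    a = toℕ y

module CirculantAdjacency (n : ℕ) .{{_ : NonZero n}} (S : List ℕ) where
  open Modular n

  y+[x-y]≡x : ∀ (x y : Fin n) → (toℕ y + (toℕ x + n ∸ toℕ y)) mod n ≡ x
  y+[x-y]≡x x y = begin
    (toℕ y + (toℕ x + n ∸ toℕ y)) mod n ≡⟨ cong (_mod n) (m+[n∸m]≡n y≤x+n) ⟩
    (toℕ x + n) mod n                   ≡⟨ [a+n]mod (toℕ x) ⟩
    toℕ x mod n                         ≡⟨ toℕ-mod-id x ⟩
    x                                   ∎
    where
    open ≡-Reasoning
    y≤x+n : toℕ y ≤ toℕ x + n
    y≤x+n = ≤-trans (<⇒≤ (toℕ<n y)) (m≤n+m n (toℕ x))

  difference⇒ : ∀ {x y : Fin n} {t} → (toℕ x + n ∸ toℕ y) % n ≡ t % n → (toℕ y + t) mod n ≡ x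
  difference⇒ {x} {y} eq = trans (mod-+ˡ (toℕ y) (%≡⇒mod≡ (sym eq))) (y+[x-y]≡x x y)

  difference⇐ : ∀ {x y : Fin n} {t} → (toℕ y + t) mod n ≡ x → (toℕ x + n ∸ toℕ y) % n ≡ t % n
  difference⇐ {x} {y} eq = mod≡⇒%≡ (mod-cancelˡ-+ (toℕ<n y) (trans (y+[x-y]≡x x y) (sym eq)))

  circulant⁺ : ∀ {s} a → s ∈ S → 0 < s → s < n →
    Circulant n S (a mod n) ((a + s) mod n) × Circulant n S ((a + s) mod n) (a mod n)
  circulant⁺ {s} a s∈S 0<s s<n =
    (distinct , s , s∈S , inj₂ (difference⇐ backward)) ,
    (distinct ∘ sym , s , s∈S , inj₁ (difference⇐ (toℕ-mod-+ a s)))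
    where
    open ≡-Reasoning
    backward : (toℕ ((a + s) mod n) + (n ∸ s)) mod n ≡ a mod n
    backward = begin
      (toℕ ((a + s) mod n) + (n ∸ s)) mod n ≡⟨ toℕ-mod-+ (a + s) (n ∸ s) ⟩
      (a + s + (n ∸ s)) mod n               ≡⟨ cong (_mod n) (+-assoc a s (n ∸ s)) ⟩
      (a + (s + (n ∸ s))) mod n             ≡⟨ cong (λ z → (a + z) mod n) (m+[n∸m]≡n (<⇒≤ s<n)) ⟩
      (a + n) mod n                         ≡⟨ [a+n]mod a ⟩
      a mod n                               ∎
    distinct : a mod n ≢ (a + s) mod n
    distinct eq = <⇒≢ 0<s (begin
      0                          ≡⟨ m<n⇒m%n≡m (>-nonZero⁻¹ n) ⟨
      0 % n                      ≡⟨ mod≡⇒%≡ (mod-cancelˡ-+ (toℕ<n (a mod n)) shifted) ⟩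
      s % n                      ≡⟨ m<n⇒m%n≡m s<n ⟩
      s                          ∎)
      where
      shifted : (toℕ (a mod n) + 0) mod n ≡ (toℕ (a mod n) + s) mod n
      shifted = trans (toℕ-mod-+ a 0) (trans (cong (_mod n) (+-identityʳ a))
                  (trans eq (sym (toℕ-mod-+ a s))))

  circulant⁻ : (∀ {s} → s ∈ S → s ≤ n) → ∀ {x y} → Circulant n S x y →
    ∃[ s ] (s ∈ S × (y ≡ (toℕ x + s) mod n ⊎ y ≡ (toℕ x + (n ∸ s)) mod n))
  circulant⁻ bounded (_ , s , s∈S , inj₁ d) =
    s , s∈S , inj₂ (mod-solve (difference⇒ d) (m+[n∸m]≡n (bounded s∈S)))
  circulant⁻ bounded (_ , s , s∈S , inj₂ d) =
    s , s∈S , inj₁ (mod-solve (difference⇒ d) (m∸n+n≡m (bounded s∈S)))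

exhaustive⇒≤length : ∀ {n} (L : List (Fin n)) → (∀ v → v ∈ L) → n ≤ length L
exhaustive⇒≤length L complete = injective⇒≤ index-injective
  where
  index-injective : ∀ {v w} → index (complete v) ≡ index (complete w) → v ≡ w
  index-injective {v} {w} eq =
    trans (lookup-index (complete v)) (trans (cong (List.lookup L) eq) (sym (lookup-index (complete w))))

module BallCounting {n} (G : Graph (Fin n)) (ball : Fin n → ℕ → List (Fin n)) (size : ℕ → ℕ)
    (InBall⇒∈ball : ∀ {x r v} → InBall G x r v → v ∈ ball x r)
    (length-ball : ∀ x r → length (ball x r) ≤ size r) where

  balls : ∀ {k} → Vec (Fin n) k → List (Fin n)
  balls [] = []
  balls {suc k} (x ∷ xs) = ball x k ++ balls xs

  ∈-balls : ∀ {k} (xs : Vec (Fin n) k) i {v} → InBall G (lookup xs i) (k ∸ suc (toℕ i)) v → v ∈ balls xs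
  ∈-balls (x ∷ xs) zero ib = ∈-++⁺ˡ (InBall⇒∈ball ib)
  ∈-balls (x ∷ xs) (suc i) ib = ∈-++⁺ʳ _ (∈-balls xs i ib)

  length-balls : ∀ {k} (xs : Vec (Fin n) k) → length (balls xs) ≤ sum (applyDownFrom size k)
  length-balls [] = z≤n
  length-balls {suc k} (x ∷ xs) = begin
    length (ball x k ++ balls xs)           ≡⟨ length-++ (ball x k) ⟩
    length (ball x k) + length (balls xs)   ≤⟨ +-mono-≤ (length-ball x k) (length-balls xs) ⟩
    size k + sum (applyDownFrom size k)     ∎
    where open ≤-Reasoning

  burningSeq⇒≤ : ∀ k xs → IsBurningSeq G k xs → n ≤ sum (applyDownFrom size k)
  burningSeq⇒≤ k xs burning =
    ≤-trans (exhaustive⇒≤length (balls xs) (λ v → ∈-balls xs (proj₁ (burning v)) (proj₂ (burning v))))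
            (length-balls xs)

crossing : ∀ (f : ℕ → ℕ) {c} i → f 0 < c → c ≤ f i → ∃[ t ] (t < i × f t < c × c ≤ f (suc t))
crossing f zero f0<c c≤f0 = ⊥-elim (<⇒≱ f0<c c≤f0)
crossing f (suc i) f0<c c≤fi+1 with _ ≤? f i
... | yes c≤fi = let t , t<i , below , above = crossing f i f0<c c≤fi in t , m<n⇒m<1+n t<i , below , above
... | no c≰fi = i , ≤-refl , ≰⇒> c≰fi , c≤fi+1

double≤odd⇒≤ : ∀ m x → 2 * m ≤ 2 * x + 1 → m ≤ x
double≤odd⇒≤ m x 2m≤2x+1 with m ≤? x
... | yes m≤x = m≤x
... | no m≰x = ⊥-elim (1+n≰n (begin
  suc (2 * x + 1) ≡⟨ double-suc x ⟨
  2 * suc x       ≤⟨ *-monoʳ-≤ 2 (≰⇒> m≰x) ⟩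
  2 * m           ≤⟨ 2m≤2x+1 ⟩
  2 * x + 1       ∎))
  where
  open ≤-Reasoning
  double-suc : ∀ x → 2 * suc x ≡ suc (2 * x + 1)
  double-suc = solve-∀

odd-square : ∀ K → (2 * suc K ∸ 1) ^ 2 ≡ 2 * (2 * (K * suc K)) + 1
odd-square = unfolded
  where
  -- the definitional unfolding of the left-hand side, with the truncated subtraction computed away
  unfolded : ∀ K → (K + (suc K + 0)) * ((K + (suc K + 0)) * 1) ≡ 2 * (2 * (K * suc K)) + 1
  unfolded = solve-∀

ceilBound⇒ : ∀ {n K} → CeilBound n (suc K) → n ≤ 2 * (K * suc K)
ceilBound⇒ {n} {K} (_ , bound) =
  *-cancelˡ-≤ 2 (+-cancelʳ-≤ 1 (2 * n) _ (subst (2 * n + 1 ≤_) (odd-square K) bound))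

ceilBound⇐ : ∀ {n K} → n ≤ 2 * (K * suc K) → CeilBound n (suc K)
ceilBound⇐ {n} {K} n≤ =
  s≤s z≤n , subst (2 * n + 1 ≤_) (sym (odd-square K)) (+-monoˡ-≤ 1 (*-monoʳ-≤ 2 n≤))

-- C(2m; 1, m) is the Möbius ladder; a rung is a pair {c, c + m}.
module MöbiusLadder (m : ℕ) (2≤m : 2 ≤ m) where

  N : ℕ
  N = 2 * m

  -- the step −1, as a natural number
  N⁻ : ℕ
  N⁻ = N ∸ 1

  0<m : 0 < m
  0<m = ≤-trans (s≤s z≤n) 2≤m

  m<N : m < N
  m<N = m<m+n m (subst (0 <_) (sym (+-identityʳ m)) 0<m)

  instance
    N-nonZero : NonZero N
    N-nonZero = >-nonZero (<-trans 0<m m<N)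

  N≡1+N⁻ : N ≡ suc N⁻
  N≡1+N⁻ = sym (m+[n∸m]≡n (<-trans 0<m m<N))

  N/2≡m : N / 2 ≡ m
  N/2≡m = trans (cong (_/ 2) (*-comm 2 m)) (m*n/n≡m m 2)

  open Modular N
  open CirculantAdjacency N (1 ∷ N / 2 ∷ [])

  G : Graph (Fin N)
  G = Circulant N (1 ∷ N / 2 ∷ [])

  [_] : ℕ → Fin N
  [ a ] = a mod N

  [a+m+m]≡[a] : ∀ a → [ a + m + m ] ≡ [ a ]
  [a+m+m]≡[a] a = trans (cong [_] (twice a m)) ([a+n]mod a)
    where
    twice : ∀ a m → a + m + m ≡ a + 2 * m
    twice = solve-∀

  unit-edges : ∀ a → G [ a ] [ suc a ] × G [ suc a ] [ a ]
  unit-edges a = subst (λ b → G [ a ] [ b ] × G [ b ] [ a ]) (+-comm a 1)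
    (circulant⁺ a (here refl) (s≤s z≤n) (≤-trans 2≤m (<⇒≤ m<N)))

  rung-edge : ∀ a → G [ a ] [ a + m ]
  rung-edge a = subst (λ h → G [ a ] [ a + h ]) N/2≡m (proj₁ (circulant⁺ a (there (here refl))
    (subst (0 <_) (sym N/2≡m) 0<m) (subst (_< N) (sym N/2≡m) m<N)))

  generator≤N : ∀ {s} → s ∈ 1 ∷ N / 2 ∷ [] → s ≤ N
  generator≤N (here refl) = <-trans 0<m m<N
  generator≤N (there (here refl)) = m/n≤m N 2

  neighbours : ∀ {x y} → G x y → y ≡ [ toℕ x + 1 ] ⊎ y ≡ [ toℕ x + N⁻ ] ⊎ y ≡ [ toℕ x + m ]
  neighbours {x} e with circulant⁻ generator≤N e
  ... | _ , here refl , inj₁ y≡ = inj₁ y≡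
  ... | _ , here refl , inj₂ y≡ = inj₂ (inj₁ y≡)
  ... | _ , there (here refl) , inj₁ y≡ = inj₂ (inj₂ (trans y≡ (cong (λ h → [ toℕ x + h ]) N/2≡m)))
  ... | _ , there (here refl) , inj₂ y≡ = inj₂ (inj₂ (trans y≡ (cong (λ h → [ toℕ x + h ]) N∸N/2≡m)))
    where
    N∸N/2≡m : N ∸ N / 2 ≡ m
    N∸N/2≡m = trans (cong (N ∸_) N/2≡m) (trans (m+n∸m≡n m (m + 0)) (+-identityʳ m))

  walk-forward : ∀ a d → Walk G [ a ] [ a + d ] d
  walk-forward a zero rewrite +-identityʳ a = here
  walk-forward a (suc d) =
    step (proj₁ (unit-edges a)) (subst (λ b → Walk G [ suc a ] [ b ] d) (sym (+-suc a d)) (walk-forward (suc a) d))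

  walk-backward : ∀ a d → Walk G [ a + d ] [ a ] d
  walk-backward a zero rewrite +-identityʳ a = here
  walk-backward a (suc d) =
    subst (λ b → Walk G [ b ] [ a ] (suc d)) (sym (+-suc a d)) (step (proj₂ (unit-edges (a + d))) (walk-backward a d))

  arc⊆ball : ∀ X r e → e ≤ r + r → InBall G [ X + r ] r [ X + e ]
  arc⊆ball X r e e≤2r with e ≤? r
  ... | yes e≤r with m≤n⇒∃[o]m+o≡n e≤r
  ...   | d , refl =
    d , m≤n+m d e , subst (λ b → Walk G [ b ] [ X + e ] d) (+-assoc X e d) (walk-backward (X + e) d)
  arc⊆ball X r e e≤2r | no e≰r with m≤n⇒∃[o]m+o≡n (<⇒≤ (≰⇒> e≰r))
  ...   | d , refl =
    d , +-cancelˡ-≤ r d r e≤2r , subst (λ b → Walk G [ X + r ] [ b ] d) (+-assoc X r d) (walk-forward (X + r) d)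

  opposite-arc⊆ball : ∀ X r e → 0 < e → e < r + r → InBall G [ X + r ] r [ X + e + m ]
  opposite-arc⊆ball X r e 0<e e<2r with e ≤? r
  ... | yes e≤r with m≤n⇒∃[o]m+o≡n e≤r
  ...   | d , refl = suc d , +-monoˡ-≤ d 0<e , step (rung-edge (X + (e + d)))
          (subst (λ b → Walk G [ b ] [ X + e + m ] d) (swap X e d m) (walk-backward (X + e + m) d))
    where
    swap : ∀ X e d m → X + e + m + d ≡ X + (e + d) + m
    swap = solve-∀
  opposite-arc⊆ball X r e 0<e e<2r | no e≰r with m≤n⇒∃[o]m+o≡n (<⇒≤ (≰⇒> e≰r))
  ...   | d , refl = suc d , +-cancelˡ-< r d r e<2r , step (rung-edge (X + r))
          (subst (λ b → Walk G [ X + r + m ] [ b ] d) (swap X r d m) (walk-forward (X + r + m) d))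
    where
    swap : ∀ X r d m → X + r + m + d ≡ X + (r + d) + m
    swap = solve-∀

  parity : ∀ j a → [ a + j * m ] ≡ [ a ] ⊎ (0 < j × [ a + j * m ] ≡ [ a + m ])
  parity zero a = inj₁ (cong [_] (+-identityʳ a))
  parity (suc j) a with parity j (a + m)
  ... | inj₁ e = inj₂ (s≤s z≤n , trans (cong [_] (sym (+-assoc a m (j * m)))) e)
  ... | inj₂ (_ , e) = inj₁ (trans (cong [_] (sym (+-assoc a m (j * m)))) (trans e ([a+m+m]≡[a] a)))

  [a+k*N]≡[a] : ∀ a k → [ a + k * suc N⁻ ] ≡ [ a ]
  [a+k*N]≡[a] a k = trans (cong (λ z → [ a + k * z ]) (sym N≡1+N⁻)) ([a+kn]mod a k)

  -- the endpoint offset of a walk with p steps +1, q steps −1 and j rung crossings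
  displacement : ℕ → ℕ → ℕ → ℕ
  displacement p q j = p + q * N⁻ + j * m

  walk-displacement : ∀ {x v ℓ} → Walk G x v ℓ →
    ∃[ p ] ∃[ q ] ∃[ j ] (p + q + j ≡ ℓ × v ≡ [ toℕ x + displacement p q j ])
  walk-displacement {x} here =
    0 , 0 , 0 , refl , trans (sym (toℕ-mod-id x)) (cong [_] (sym (+-identityʳ (toℕ x))))
  walk-displacement {x} (step e w) with walk-displacement w | neighbours e
  ... | p , q , j , len , v≡ | inj₁ y≡ =
    suc p , q , j , cong suc len , trans v≡ (trans (≡⇒toℕ-mod-+ _ y≡) (cong [_] (move-p (toℕ x) p q j N⁻ m)))
    where
    move-p : ∀ a p q j k m → a + 1 + (p + q * k + j * m) ≡ a + (suc p + q * k + j * m)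
    move-p = solve-∀
  ... | p , q , j , len , v≡ | inj₂ (inj₁ y≡) =
    p , suc q , j , trans (cong (_+ j) (+-suc p q)) (cong suc len) ,
    trans v≡ (trans (≡⇒toℕ-mod-+ _ y≡) (cong [_] (move-q (toℕ x) p q j N⁻ m)))
    where
    move-q : ∀ a p q j k m → a + k + (p + q * k + j * m) ≡ a + (p + suc q * k + j * m)
    move-q = solve-∀
  ... | p , q , j , len , v≡ | inj₂ (inj₂ y≡) =
    p , q , suc j , trans (+-suc (p + q) j) (cong suc len) ,
    trans v≡ (trans (≡⇒toℕ-mod-+ _ y≡) (cong [_] (move-j (toℕ x) p q j N⁻ m)))
    where
    move-j : ∀ a p q j k m → a + m + (p + q * k + j * m) ≡ a + (p + q * k + suc j * m)
    move-j = solve-∀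

  arc : ℕ → ℕ → List (Fin N)
  arc a r = applyUpTo (λ e → [ a + e ]) (suc r) ++ applyUpTo (λ c → [ a + suc c * N⁻ ]) r

  length-arc : ∀ a r → length (arc a r) ≡ suc r + r
  length-arc a r = trans (length-++ (applyUpTo (λ e → [ a + e ]) (suc r)))
    (cong₂ _+_ (length-applyUpTo (λ e → [ a + e ]) (suc r)) (length-applyUpTo (λ c → [ a + suc c * N⁻ ]) r))

  -- q * N⁻ ≡ −q (mod N): the offset is p − q.
  arc-complete : ∀ a {p q r} → p + q ≤ r → [ a + (p + q * N⁻) ] ∈ arc a r
  arc-complete a {p} {q} {r} p+q≤r with q ≤? p
  ... | yes q≤p with m≤n⇒∃[o]m+o≡n q≤p
  ...   | e , refl =
    subst (_∈ arc a r) (sym [a+e]) (∈-++⁺ˡ (∈-applyUpTo⁺ (λ e → [ a + e ]) (s≤s e≤r)))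
    where
    e≤r : e ≤ r
    e≤r = ≤-trans (≤-trans (m≤n+m e q) (m≤m+n (q + e) q)) p+q≤r
    cancel : ∀ a q e k → a + (q + e + q * k) ≡ a + e + q * suc k
    cancel = solve-∀
    [a+e] : [ a + (q + e + q * N⁻) ] ≡ [ a + e ]
    [a+e] = trans (cong [_] (cancel a q e N⁻)) ([a+k*N]≡[a] (a + e) q)
  arc-complete a {p} {q} {r} p+q≤r | no q≰p with m≤n⇒∃[o]m+o≡n (≰⇒> q≰p)
  ...   | c , refl =
    subst (_∈ arc a r) (sym [a-c-1]) (∈-++⁺ʳ _ (∈-applyUpTo⁺ (λ c → [ a + suc c * N⁻ ]) c<r))
    where
    c<r : c < r
    c<r = ≤-trans (≤-trans (s≤s (m≤n+m c p)) (m≤n+m (suc p + c) p)) p+q≤r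
    cancel : ∀ a p c k → a + (p + (suc p + c) * k) ≡ a + suc c * k + p * suc k
    cancel = solve-∀
    [a-c-1] : [ a + (p + (suc p + c) * N⁻) ] ≡ [ a + suc c * N⁻ ]
    [a-c-1] = trans (cong [_] (cancel a p c N⁻)) ([a+k*N]≡[a] (a + suc c * N⁻) p)

  -- N_r[a] ⊆ arc a r ∪ arc (a + m) (r − 1), of size 4r for r ≥ 1.
  ballList : ℕ → ℕ → List (Fin N)
  ballList a zero = arc a zero
  ballList a (suc r) = arc a (suc r) ++ arc (a + m) r

  ballSize : ℕ → ℕ
  ballSize zero = 1
  ballSize (suc r) = 4 * suc r

  length-ballList : ∀ a r → length (ballList a r) ≡ ballSize r
  length-ballList a zero = refl
  length-ballList a (suc r) = begin
    length (arc a (suc r) ++ arc (a + m) r)          ≡⟨ length-++ (arc a (suc r)) ⟩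
    length (arc a (suc r)) + length (arc (a + m) r)  ≡⟨ cong₂ _+_ (length-arc a (suc r)) (length-arc (a + m) r) ⟩
    suc (suc r) + suc r + (suc r + r)                ≡⟨ four-arcs r ⟩
    4 * suc r                                        ∎
    where
    open ≡-Reasoning
    four-arcs : ∀ r → suc (suc r) + suc r + (suc r + r) ≡ 4 * suc r
    four-arcs = solve-∀

  sum-ballSize : ∀ j → sum (applyDownFrom ballSize (suc j)) ≡ 2 * (j * suc j) + 1
  sum-ballSize zero = refl
  sum-ballSize (suc j) = trans (cong (4 * suc j +_) (sum-ballSize j)) (next j)
    where
    next : ∀ j → 4 * suc j + (2 * (j * suc j) + 1) ≡ 2 * (suc j * suc (suc j)) + 1
    next = solve-∀

  displacement∈ballList : ∀ a r p q j → p + q + j ≤ r → [ a + displacement p q j ] ∈ ballList a r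
  displacement∈ballList a r p q j bound with parity j (a + (p + q * N⁻))
  ... | inj₁ e = subst (_∈ ballList a r) (sym (trans (cong [_] (sym (+-assoc a _ (j * m)))) e))
                   (arc⊆ballList r (arc-complete a {p} {q} (≤-trans (m≤m+n (p + q) j) bound)))
    where
    arc⊆ballList : ∀ r {v} → v ∈ arc a r → v ∈ ballList a r
    arc⊆ballList zero v∈ = v∈
    arc⊆ballList (suc r) v∈ = ∈-++⁺ˡ v∈
  displacement∈ballList a zero p q j bound | inj₂ (0<j , e) =
    ⊥-elim (<⇒≱ 0<j (≤-trans (m≤n+m j (p + q)) bound))
  displacement∈ballList a (suc r) p q j bound | inj₂ (0<j , e) =
    subst (_∈ ballList a (suc r)) (sym (trans (cong [_] (sym (+-assoc a _ (j * m)))) (trans e (cong [_] (swap a m _)))))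
      (∈-++⁺ʳ (arc a (suc r)) (arc-complete (a + m) {p} {q} (s≤s⁻¹ (<-≤-trans (m<m+n (p + q) 0<j) bound))))
    where
    swap : ∀ a m o → a + o + m ≡ a + m + o
    swap = solve-∀

  InBall⇒∈ballList : ∀ {x r v} → InBall G x r v → v ∈ ballList (toℕ x) r
  InBall⇒∈ballList {x} {r} (ℓ , ℓ≤r , w) with walk-displacement w
  ... | p , q , j , refl , v≡ =
    subst (_∈ ballList (toℕ x) r) (sym v≡) (displacement∈ballList (toℕ x) r p q j ℓ≤r)

  burningSeq⇒ceilBound : ∀ k xs → IsBurningSeq G k xs → CeilBound N k
  burningSeq⇒ceilBound zero xs burning = ⊥-elim (¬Fin0 (proj₁ (burning [ 0 ])))
  burningSeq⇒ceilBound (suc j) xs burning =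
    ceilBound⇐ (*-monoʳ-≤ 2 (double≤odd⇒≤ m (j * suc j) (subst (N ≤_) (sum-ballSize j) N≤)))
    where
    open BallCounting G (λ x → ballList (toℕ x)) ballSize InBall⇒∈ballList
                        (λ x r → ≤-reflexive (length-ballList (toℕ x) r))
    N≤ : N ≤ sum (applyDownFrom ballSize (suc j))
    N≤ = burningSeq⇒≤ (suc j) xs burning

  module Cover (K : ℕ) (m≤K[K+1] : m ≤ K * suc K) where

    radius : ℕ → ℕ
    radius t = K ∸ t

    start : ℕ → ℕ
    start zero = 0
    start (suc t) = start t + (radius t + radius t)

    -- Ball t covers the rungs start t + 1, …, start (suc t). The shift t * m puts consecutive
    -- balls on opposite sides of the ladder, so the vertex the ball t misses on its last rung is
    -- the first vertex of ball t + 1.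
    centre : ℕ → ℕ
    centre t = start t + t * m + radius t

    centres : Vec (Fin N) (suc K)
    centres = tabulate (λ i → [ centre (toℕ i) ])

    Burnt : Fin N → Set
    Burnt v = ∃[ i ] InBall G (lookup centres i) (suc K ∸ suc (toℕ i)) v

    ball-burnt : ∀ {t v} → t ≤ K → InBall G [ centre t ] (radius t) v → Burnt v
    ball-burnt {t} {v} t≤K ib = i , subst₂ (λ x r → InBall G x r v) (sym lookup-i) (cong (K ∸_) (sym toℕ-i)) ib
      where
      i = fromℕ< (s≤s t≤K)
      toℕ-i : toℕ i ≡ t
      toℕ-i = toℕ-fromℕ< (s≤s t≤K)
      lookup-i : lookup centres i ≡ [ centre t ]
      lookup-i = trans (lookup∘tabulate (λ j → [ centre (toℕ j) ]) i) (cong (λ z → [ centre z ]) toℕ-i)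

    start+radius : ∀ t → t ≤ K → start t + radius t * suc (radius t) ≡ K * suc K
    start+radius zero _ = refl
    start+radius (suc t) t<K = begin
      start t + (radius t + radius t) + r * suc r   ≡⟨ cong (λ z → start t + (z + z) + r * suc r) radius≡ ⟩
      start t + (suc r + suc r) + r * suc r         ≡⟨ regroup (start t) r ⟩
      start t + suc r * suc (suc r)                 ≡⟨ cong (λ z → start t + z * suc z) radius≡ ⟨
      start t + radius t * suc (radius t)           ≡⟨ start+radius t (<⇒≤ t<K) ⟩
      K * suc K                                     ∎
      where
      open ≡-Reasoning
      r = K ∸ suc t
      radius≡ : radius t ≡ suc r
      radius≡ = +-∸-assoc 1 t<K
      regroup : ∀ s r → s + (suc r + suc r) + r * suc r ≡ s + suc r * suc (suc r)
      regroup = solve-∀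

    start-K : start K ≡ K * suc K
    start-K = begin
      start K                               ≡⟨ +-identityʳ (start K) ⟨
      start K + 0                           ≡⟨ cong (λ r → start K + r * suc r) (n∸n≡0 K) ⟨
      start K + radius K * suc (radius K)   ≡⟨ start+radius K ≤-refl ⟩
      K * suc K                             ∎
      where open ≡-Reasoning

    Rung : ℕ → Set
    Rung c = Burnt [ c ] × Burnt [ c + m ]

    rung-unshift : ∀ c t → Rung (c + t * m) → Rung c
    rung-unshift c t (b₁ , b₂) with parity t c
    ... | inj₁ e = subst Burnt e b₁ , subst Burnt (mod-+ʳ m e) b₂
    ... | inj₂ (_ , e) = subst Burnt ([a+m+m]≡[a] c) (subst Burnt (mod-+ʳ m e) b₂) , subst Burnt e b₁

    block-rung : ∀ t e → t < K → 0 < e → e ≤ radius t + radius t → Rung (start t + e + t * m)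
    block-rung t e t<K 0<e e≤2r = near , far
      where
      X = start t + t * m
      reorder : ∀ s e o → s + o + e ≡ s + e + o
      reorder = solve-∀
      near : Burnt [ start t + e + t * m ]
      near = subst (λ a → Burnt [ a ]) (reorder (start t) e (t * m))
               (ball-burnt (<⇒≤ t<K) (arc⊆ball X (radius t) e e≤2r))
      far : Burnt [ start t + e + t * m + m ]
      far with m≤n⇒m<n∨m≡n e≤2r
      ... | inj₁ e<2r = subst (λ a → Burnt [ a + m ]) (reorder (start t) e (t * m))
                          (ball-burnt (<⇒≤ t<K) (opposite-arc⊆ball X (radius t) e 0<e e<2r))
      ... | inj₂ refl = subst (λ a → Burnt [ a ]) (next-start (start t) e (t * m) m)
                          (ball-burnt t<K (arc⊆ball (start (suc t) + suc t * m) (radius (suc t)) 0 z≤n))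
        where
        next-start : ∀ s e o m → s + e + (m + o) + 0 ≡ s + e + o + m
        next-start = solve-∀

    rung-burnt : ∀ c → 0 < c → c ≤ m → Rung c
    rung-burnt c 0<c c≤m with crossing start K 0<c (subst (c ≤_) (sym start-K) (≤-trans c≤m m≤K[K+1]))
    ... | t , t<K , below , above with m≤n⇒∃[o]m+o≡n (<⇒≤ below)
    ...   | e , refl = rung-unshift (start t + e) t (block-rung t e t<K 0<e (+-cancelˡ-≤ (start t) e _ above))
      where
      0<e : 0 < e
      0<e = +-cancelˡ-< (start t) 0 e (subst (_< start t + e) (sym (+-identityʳ (start t))) below)

    burnt : ∀ v → Burnt v
    burnt v = subst Burnt (toℕ-mod-id v) (burnt-< (toℕ v) (toℕ<n v))
      where
      burnt-< : ∀ a → a < N → Burnt [ a ]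
      burnt-< zero _ = subst Burnt ([a+m+m]≡[a] 0) (proj₂ (rung-burnt m 0<m ≤-refl))
      burnt-< (suc a) a<N with suc a ≤? m
      ... | yes a≤m = proj₁ (rung-burnt (suc a) (s≤s z≤n) a≤m)
      ... | no a≰m with m≤n⇒∃[o]m+o≡n (≰⇒> a≰m)
      ...   | c , refl = subst (λ b → Burnt [ b ]) (trans (+-comm (suc c) m) (+-suc m c))
                (proj₂ (rung-burnt (suc c) (s≤s z≤n) 1+c≤m))
        where
        1+c≤m : suc c ≤ m
        1+c≤m = <⇒≤ (+-cancelˡ-< m (suc c) m (subst₂ _<_ (sym (+-suc m c)) (cong (m +_) (+-identityʳ m)) a<N))

  ceilBound⇒burningSeq : ∀ k → CeilBound N k → Σ (Vec (Fin N) k) (IsBurningSeq G k)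
  ceilBound⇒burningSeq zero (() , _)
  ceilBound⇒burningSeq (suc K) bound = centres , burnt
    where open Cover K (*-cancelˡ-≤ 2 (ceilBound⇒ bound))

mainTheorem2 : (n : ℕ) → .{{_ : NonZero n}} → 4 ≤ n → ∃[ m ] n ≡ 2 * m →
    (k : ℕ) → IsCeilHalfOnePlusSqrt n k →
    IsBurningNumber (Circulant n (1 ∷ n / 2 ∷ [])) k
mainTheorem2 .(2 * m) 4≤2m (m , refl) k (k-bound , k-least) =
  ceilBound⇒burningSeq k k-bound , λ k′ xs burning → k-least k′ (burningSeq⇒ceilBound k′ xs burning)
  where open MöbiusLadder m (*-cancelˡ-≤ 2 4≤2m)
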